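{- Let $s\ge1$, $1\le h\le m$ and $g\ge0$ be integers. The number of compositions $(a_1,\dots,a_h)$ of $m$ into $h$ positive parts with $\sum_{i=1}^h\max(a_i-s-1,0)=g$ (equivalently, whose deletion of the first $s+1$ columns has weight $g$) equals $c^{(s)mg}_{h}$, where for $g\ne0$ $$c^{(s)mg}_{h}=\frac1g\sum_{k=1}^{g}\ \sum k\binom{h}{f_1}\binom{f_1}{f_2}\cdots\binom{f_{s-1}}{f_s}\binom{f_s}{k}\binom{g}{k},$$ the inner sum over integers $h\ge f_1\ge\cdots\ge f_s\ge k$ with $f_1+\cdots+f_s=m-h-g$, and $$c^{(s)m0}_{h}=\sum\binom{h}{f_1}\binom{f_1}{f_2}\cdots\binom{f_{s-1}}{f_s},$$ the sum over integers $h\ge f_1\ge\cdots\ge f_s\ge0$ with $f_1+\cdots+f_s=m-h$.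
   Context: A composition of weight $m$ and dimension $h$ is an ordered $h$-tuple of positive integers summing to $m$. Deleting the first $s+1$ columns of $(a_1,\dots,a_h)$ yields $(a_i-s-1)_{i:\,a_i\ge s+2}$, a composition of weight $\sum_i\max(a_i-s-1,0)$. Binomial coefficients $\binom ab$ are $0$ unless $0\le b\le a$. -}

module Defs where

open import Data.Nat using (ℕ; zero; suc; _+_; _*_; _∸_; _≤_; _≤?_; _≟_)
open import Data.Nat.Combinatorics using (_C_)
open import Data.List using (List; []; _∷_; [_]; map; concatMap; upTo; length; filter; _++_)
open import Data.Nat.ListAction using (sum)
open import Data.Vec using (Vec; toList)
import Data.Vec as V
open import Data.Vec.Relation.Unary.All using (All; all?)
open import Data.Product using (_×_)
open import Data.Unit using (⊤)
open import Relation.Nullary using (Dec; yes)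
open import Relation.Nullary.Decidable using (_×-dec_)
open import Relation.Binary.PropositionalEquality using (_≡_)
open import Data.Integer using (+_)
open import Data.Rational using (ℚ; _/_)

vecsBelow : (h b : ℕ) → List (Vec ℕ h)
vecsBelow zero    b = V.[] ∷ []
vecsBelow (suc h) b = concatMap (λ a → map (a V.∷_) (vecsBelow h b)) (upTo b)

IsComposition : (m h : ℕ) → Vec ℕ h → Set
IsComposition m h v = All (λ a → 1 ≤ a) v × V.sum v ≡ m

isComposition? : (m h : ℕ) (v : Vec ℕ h) → Dec (IsComposition m h v)
isComposition? m h v = all? (λ a → 1 ≤? a) v ×-dec (V.sum v ≟ m)

-- Weight of the composition obtained by deleting the first s+1 columns:
-- ∑ᵢ max(aᵢ − s − 1, 0)  (truncated subtraction ∸ is exactly max(·,0)).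
deletionWeight : (s : ℕ) {h : ℕ} → Vec ℕ h → ℕ
deletionWeight s v = V.sum (V.map (λ a → a ∸ suc s) v)

-- Every part of a composition of m is ≤ m,
-- so enumerating the box [0,m]^h finds all of them, each exactly once.
compositionCount : (s m h g : ℕ) → ℕ
compositionCount s m h g =
  length (filter (λ v → isComposition? m h v ×-dec (deletionWeight s v ≟ g))
                 (vecsBelow h (suc m)))

Descending : List ℕ → Set
Descending []            = ⊤
Descending (x ∷ [])      = ⊤
Descending (x ∷ y ∷ xs)  = (y ≤ x) × Descending (y ∷ xs)

descending? : (xs : List ℕ) → Dec (Descending xs)
descending? []           = yes _
descending? (x ∷ [])     = yes _
descending? (x ∷ y ∷ xs) = (y ≤? x) ×-dec descending? (y ∷ xs)

binomChain : List ℕ → ℕ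
binomChain []           = 1
binomChain (x ∷ [])     = 1
binomChain (x ∷ y ∷ xs) = (x C y) * binomChain (y ∷ xs)

-- Tuples (f₁,…,f_s) with h ≥ f₁ ≥ ⋯ ≥ f_s ≥ k and f₁+⋯+f_s + h + g = m
-- (i.e. f₁+⋯+f_s = m − h − g as integers).  All fᵢ ≤ h, so the box
-- [0,h]^s contains all of them.
chainsK : (s m h g k : ℕ) → List (Vec ℕ s)
chainsK s m h g k =
  filter (λ f → descending? (h ∷ toList f ++ [ k ]) ×-dec (V.sum f + h + g ≟ m))
         (vecsBelow s (suc h))

innerSum : (s m h g k : ℕ) → ℕ
innerSum s m h g k =
  sum (map (λ f → k * binomChain (h ∷ toList f ++ [ k ]) * (g C k)) (chainsK s m h g k))

chains0 : (s m h : ℕ) → List (Vec ℕ s)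
chains0 s m h =
  filter (λ f → descending? (h ∷ toList f) ×-dec (V.sum f + h ≟ m))
         (vecsBelow s (suc h))

oneTo : ℕ → List ℕ
oneTo g = map suc (upTo g)

c : (s m h g : ℕ) → ℚ
c s m h zero    = + sum (map (λ f → binomChain (h ∷ toList f)) (chains0 s m h)) / 1
c s m h (suc g) = + sum (map (innerSum s m h (suc g)) (oneTo (suc g))) / suc g

-- Let N_t(h, m, g) count the compositions of m into h parts whose deletion of the first t
-- columns has weight g. Deleting one more column removes the parts equal to 1 and lowers the
-- others by one, so N_{t+1}(h, h + M, g) = ∑_f C(h, f) N_t(f, M, g), where f is the number of
-- surviving parts. Starting from N_0(k, g + E, g) = [E = 0] C(g − 1, k − 1) and iterating s + 1
-- times gives N_{s+1}(h, h + g + E, g) = ∑_k C(g − 1, k − 1) ∑ C(h, f₁) C(f₁, f₂) ⋯ C(f_s, k),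
-- the inner sum over f₁ + ⋯ + f_s = E, and g C(g − 1, k − 1) = k C(g, k) turns this into the
-- formula of the statement.
module Submission where

open import Defs
open import Data.Nat using (ℕ; _≤_; zero; suc; _+_; _*_; _∸_; _<_; _≤?_; _≟_; z≤n; s≤s; s≤s⁻¹; z<s)
open import Data.Integer using (+_)
open import Data.Rational using (ℚ; _/_)
open import Relation.Binary.PropositionalEquality using (_≡_; _≢_; refl; sym; trans; cong; cong₂; subst; module ≡-Reasoning)

open import Algebra.Properties.CommutativeSemigroup as CommSemigroupProperties using ()
open import Data.Bool using (if_then_else_)
open import Data.Empty using (⊥-elim)
import Data.Integer as ℤ
open import Data.Integer.Properties using (pos-*)
open import Data.List using (List; []; _∷_; [_]; _++_; map; concatMap; applyUpTo; upTo; length; filter)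
open import Data.List.Properties using (map-∘; map-cong; map-++)
open import Data.Nat.Combinatorics using (_C_; k>n⇒nCk≡0; nCk+nC[k+1]≡[n+1]C[k+1]; nC1≡n)
open import Data.Nat.ListAction using (sum)
open import Data.Nat.ListAction.Properties using (sum-++)
open import Data.Nat.Properties
open import Data.Nat.Tactic.RingSolver using (solve-∀)
open import Data.Product using (_×_; _,_)
open import Data.Rational.Properties using (fromℚᵘ-cong)
open import Data.Rational.Unnormalised.Base using (mkℚᵘ; *≡*)
open import Data.Unit using (tt)
open import Data.Vec using (Vec; toList)
import Data.Vec as V
open import Data.Vec.Relation.Unary.All using (_∷_)
open import Function using (_∘_)
open import Relation.Nullary using (Dec; yes; no; does; ¬_)
open import Relation.Nullary.Decidable using (_×-dec_)

private
  module +-CS = CommSemigroupProperties +-commutativeSemigroup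
  module *-CS = CommSemigroupProperties *-commutativeSemigroup

𝟙 : ∀ {p} {P : Set p} → Dec P → ℕ
𝟙 d = if does d then 1 else 0

𝟙-yes : ∀ {p} {P : Set p} → P → (d : Dec P) → 𝟙 d ≡ 1
𝟙-yes p (yes _) = refl
𝟙-yes p (no ¬p) = ⊥-elim (¬p p)

𝟙-no : ∀ {p} {P : Set p} → ¬ P → (d : Dec P) → 𝟙 d ≡ 0
𝟙-no ¬p (yes p) = ⊥-elim (¬p p)
𝟙-no ¬p (no _)  = refl

𝟙-cong : ∀ {p q} {P : Set p} {Q : Set q} (d : Dec P) (e : Dec Q) → (P → Q) → (Q → P) → 𝟙 d ≡ 𝟙 e
𝟙-cong (yes p) e P⇒Q Q⇒P = sym (𝟙-yes (P⇒Q p) e)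
𝟙-cong (no ¬p) e P⇒Q Q⇒P = sym (𝟙-no (¬p ∘ Q⇒P) e)

𝟙-× : ∀ {p q} {P : Set p} {Q : Set q} (d : Dec P) (e : Dec Q) → 𝟙 (d ×-dec e) ≡ 𝟙 d * 𝟙 e
𝟙-× (yes _) (yes _) = refl
𝟙-× (yes _) (no _)  = refl
𝟙-× (no _)  (yes _) = refl
𝟙-× (no _)  (no _)  = refl

𝟙*-vanish : ∀ {p} {P : Set p} (d : Dec P) {y : ℕ} → (P → y ≡ 0) → 𝟙 d * y ≡ 0
𝟙*-vanish (yes p) y≡0 = trans (+-identityʳ _) (y≡0 p)
𝟙*-vanish (no _)  _   = refl

δ₀ : ℕ → ℕ
δ₀ zero    = 1
δ₀ (suc _) = 0

∑ : ℕ → (ℕ → ℕ) → ℕ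
∑ zero    F = 0
∑ (suc n) F = F 0 + ∑ n (F ∘ suc)

syntax ∑ n (λ i → e) = ∑[ i < n ] e

∑-cong : ∀ n {F G : ℕ → ℕ} → (∀ i → i < n → F i ≡ G i) → ∑ n F ≡ ∑ n G
∑-cong zero    eq = refl
∑-cong (suc n) eq = cong₂ _+_ (eq 0 (s≤s z≤n)) (∑-cong n (λ i i<n → eq (suc i) (s≤s i<n)))

∑-vanish : ∀ n {F : ℕ → ℕ} → (∀ i → i < n → F i ≡ 0) → ∑ n F ≡ 0
∑-vanish n F≡0 = trans (∑-cong n F≡0) (∑0≡0 n)
  where
  ∑0≡0 : ∀ n → ∑[ _ < n ] 0 ≡ 0
  ∑0≡0 zero    = refl
  ∑0≡0 (suc n) = ∑0≡0 n

∑-distrib-+ : ∀ n (F G : ℕ → ℕ) → ∑[ i < n ] (F i + G i) ≡ ∑ n F + ∑ n G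
∑-distrib-+ zero    F G = refl
∑-distrib-+ (suc n) F G = trans (cong (_+_ (F 0 + G 0)) (∑-distrib-+ n (F ∘ suc) (G ∘ suc)))
                                (+-CS.interchange (F 0) (G 0) _ _)

*-distribˡ-∑ : ∀ n c (F : ℕ → ℕ) → c * ∑ n F ≡ ∑[ i < n ] (c * F i)
*-distribˡ-∑ zero    c F = *-zeroʳ c
*-distribˡ-∑ (suc n) c F = trans (*-distribˡ-+ c (F 0) _) (cong (_+_ (c * F 0)) (*-distribˡ-∑ n c (F ∘ suc)))

∑-comm : ∀ n m (F : ℕ → ℕ → ℕ) → ∑[ i < n ] ∑[ j < m ] F i j ≡ ∑[ j < m ] ∑[ i < n ] F i j
∑-comm zero    m F = sym (∑-vanish m (λ _ _ → refl))
∑-comm (suc n) m F = begin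
  ∑ m (F 0) + ∑[ i < n ] ∑[ j < m ] F (suc i) j  ≡⟨ cong (_+_ (∑ m (F 0))) (∑-comm n m (F ∘ suc)) ⟩
  ∑ m (F 0) + ∑[ j < m ] ∑[ i < n ] F (suc i) j  ≡⟨ ∑-distrib-+ m (F 0) _ ⟨
  ∑[ j < m ] (F 0 j + ∑[ i < n ] F (suc i) j)    ∎
  where open ≡-Reasoning

∑-split : ∀ a b (F : ℕ → ℕ) → ∑ (a + b) F ≡ ∑ a F + ∑[ i < b ] F (a + i)
∑-split zero    b F = refl
∑-split (suc a) b F = trans (cong (_+_ (F 0)) (∑-split a b (F ∘ suc))) (sym (+-assoc (F 0) _ _))

∑-truncate : ∀ n N (F : ℕ → ℕ) → n ≤ N → (∀ i → n ≤ i → i < N → F i ≡ 0) → ∑ N F ≡ ∑ n F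
∑-truncate n N F n≤N tail≡0 = begin
  ∑ N F                                ≡⟨ cong (λ k → ∑ k F) (m+[n∸m]≡n n≤N) ⟨
  ∑ (n + (N ∸ n)) F                    ≡⟨ ∑-split n (N ∸ n) F ⟩
  ∑ n F + ∑[ i < N ∸ n ] F (n + i)     ≡⟨ cong (_+_ (∑ n F)) (∑-vanish (N ∸ n) inTail) ⟩
  ∑ n F + 0                            ≡⟨ +-identityʳ _ ⟩
  ∑ n F                                ∎
  where
  open ≡-Reasoning
  inTail : ∀ i → i < N ∸ n → F (n + i) ≡ 0
  inTail i i<N∸n = tail≡0 (n + i) (m≤m+n n i) (subst (n + i <_) (m+[n∸m]≡n n≤N) (+-monoʳ-< n i<N∸n))

∑-bounds : ∀ a b (F : ℕ → ℕ) → (∀ i → a ≤ i → F i ≡ 0) → (∀ i → b ≤ i → F i ≡ 0) → ∑ a F ≡ ∑ b F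
∑-bounds a b F beyondA beyondB = trans (sym (∑-truncate a (a + b) F (m≤m+n a b) (λ i a≤i _ → beyondA i a≤i)))
                                       (∑-truncate b (a + b) F (m≤n+m b a) (λ i b≤i _ → beyondB i b≤i))

∑-pascal : ∀ h (F : ℕ → ℕ) →
  ∑[ f < suc h ] ((h C f) * F f) + ∑[ f < suc h ] ((h C f) * F (suc f)) ≡ ∑[ f < suc (suc h) ] ((suc h C f) * F f)
∑-pascal h F = begin
  (F₀ + A) + B                                   ≡⟨ +-assoc F₀ A B ⟩
  F₀ + (A + B)                                   ≡⟨ cong (λ x → F₀ + (x + B)) A⁺≡A ⟨
  F₀ + (A⁺ + B)                                  ≡⟨ cong (_+_ F₀) (+-comm A⁺ B) ⟩
  F₀ + (B + A⁺)                                  ≡⟨ cong (_+_ F₀) (∑-distrib-+ (suc h) (λ f → (h C f) * F (suc f)) (λ f → (h C suc f) * F (suc f))) ⟨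
  F₀ + ∑[ f < suc h ] ((h C f) * F (suc f) + (h C suc f) * F (suc f))
                                                 ≡⟨ cong (_+_ F₀) (∑-cong (suc h) pascal) ⟩
  F₀ + ∑[ f < suc h ] ((suc h C suc f) * F (suc f)) ∎
  where
  open ≡-Reasoning
  F₀ = 1 * F 0
  A = ∑[ f < h ] ((h C suc f) * F (suc f))
  A⁺ = ∑[ f < suc h ] ((h C suc f) * F (suc f))
  B = ∑[ f < suc h ] ((h C f) * F (suc f))
  A⁺≡A : A⁺ ≡ A
  A⁺≡A = ∑-truncate h (suc h) _ (n≤1+n h) (λ f h≤f _ → cong (_* F (suc f)) (k>n⇒nCk≡0 (s≤s h≤f)))
  pascal : ∀ f → f < suc h → (h C f) * F (suc f) + (h C suc f) * F (suc f) ≡ (suc h C suc f) * F (suc f)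
  pascal f _ = trans (sym (*-distribʳ-+ (F (suc f)) (h C f) _)) (cong (_* F (suc f)) (nCk+nC[k+1]≡[n+1]C[k+1] h f))

sum-map-cong : ∀ {a} {A : Set a} (xs : List A) {F G : A → ℕ} → (∀ x → F x ≡ G x) → sum (map F xs) ≡ sum (map G xs)
sum-map-cong xs eq = cong sum (map-cong eq xs)

*-distribˡ-sum-map : ∀ {a} {A : Set a} (xs : List A) c (F : A → ℕ) → c * sum (map F xs) ≡ sum (map (λ x → c * F x) xs)
*-distribˡ-sum-map []       c F = *-zeroʳ c
*-distribˡ-sum-map (x ∷ xs) c F = trans (*-distribˡ-+ c (F x) _) (cong (_+_ (c * F x)) (*-distribˡ-sum-map xs c F))

sum-map-applyUpTo : ∀ n (f F : ℕ → ℕ) → sum (map F (applyUpTo f n)) ≡ ∑[ i < n ] F (f i)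
sum-map-applyUpTo zero    f F = refl
sum-map-applyUpTo (suc n) f F = cong (_+_ (F (f 0))) (sum-map-applyUpTo n (f ∘ suc) F)

sum-map-concatMap : ∀ {a b} {A : Set a} {B : Set b} (xs : List A) (G : A → List B) (F : B → ℕ) →
  sum (map F (concatMap G xs)) ≡ sum (map (λ x → sum (map F (G x))) xs)
sum-map-concatMap []       G F = refl
sum-map-concatMap (x ∷ xs) G F = begin
  sum (map F (G x ++ concatMap G xs))               ≡⟨ cong sum (map-++ F (G x) _) ⟩
  sum (map F (G x) ++ map F (concatMap G xs))       ≡⟨ sum-++ (map F (G x)) _ ⟩
  sum (map F (G x)) + sum (map F (concatMap G xs))  ≡⟨ cong (_+_ (sum (map F (G x)))) (sum-map-concatMap xs G F) ⟩
  sum (map (λ x → sum (map F (G x))) (x ∷ xs))      ∎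
  where open ≡-Reasoning

length-filter≡sum-𝟙 : ∀ {a p} {A : Set a} {P : A → Set p} (P? : ∀ x → Dec (P x)) (xs : List A) →
  length (filter P? xs) ≡ sum (map (𝟙 ∘ P?) xs)
length-filter≡sum-𝟙 P? []       = refl
length-filter≡sum-𝟙 P? (x ∷ xs) with P? x
... | yes _ = cong suc (length-filter≡sum-𝟙 P? xs)
... | no _  = length-filter≡sum-𝟙 P? xs

sum-map-filter : ∀ {a p} {A : Set a} {P : A → Set p} (P? : ∀ x → Dec (P x)) (F : A → ℕ) (xs : List A) →
  sum (map F (filter P? xs)) ≡ sum (map (λ x → 𝟙 (P? x) * F x) xs)
sum-map-filter P? F []       = refl
sum-map-filter P? F (x ∷ xs) with P? x
... | yes _ = cong₂ _+_ (sym (+-identityʳ (F x))) (sum-map-filter P? F xs)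
... | no _  = sum-map-filter P? F xs

boxSum : ∀ n → ℕ → (Vec ℕ n → ℕ) → ℕ
boxSum n B W = sum (map W (vecsBelow n B))

boxSum-cong : ∀ n B {W W′ : Vec ℕ n → ℕ} → (∀ v → W v ≡ W′ v) → boxSum n B W ≡ boxSum n B W′
boxSum-cong n B = sum-map-cong (vecsBelow n B)

*-distribˡ-boxSum : ∀ n B c (W : Vec ℕ n → ℕ) → c * boxSum n B W ≡ boxSum n B (λ v → c * W v)
*-distribˡ-boxSum n B = *-distribˡ-sum-map (vecsBelow n B)

boxSum-vanish : ∀ n B {W : Vec ℕ n → ℕ} → (∀ v → W v ≡ 0) → boxSum n B W ≡ 0
boxSum-vanish n B W≡0 = trans (boxSum-cong n B W≡0) (sym (*-distribˡ-boxSum n B 0 (λ _ → 0)))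

boxSum-suc : ∀ n B (W : Vec ℕ (suc n) → ℕ) → boxSum (suc n) B W ≡ ∑[ a < B ] boxSum n B (W ∘ (a V.∷_))
boxSum-suc n B W = begin
  sum (map W (concatMap (λ a → map (a V.∷_) (vecsBelow n B)) (upTo B)))
    ≡⟨ sum-map-concatMap (upTo B) _ W ⟩
  sum (map (λ a → sum (map W (map (a V.∷_) (vecsBelow n B)))) (upTo B))
    ≡⟨ sum-map-cong (upTo B) (λ a → cong sum (sym (map-∘ (vecsBelow n B)))) ⟩
  sum (map (λ a → boxSum n B (W ∘ (a V.∷_))) (upTo B))
    ≡⟨ sum-map-applyUpTo B (λ a → a) _ ⟩
  ∑[ a < B ] boxSum n B (W ∘ (a V.∷_)) ∎
  where open ≡-Reasoning

-- Counting compositions by deletion weight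

-- Compositions (a₁,…,a_h) of m with ∑ᵢ max(aᵢ − t, 0) = g, counted by their first part a.
deletionCount : (t h m g : ℕ) → ℕ
deletionCount t zero    m g = δ₀ m * δ₀ g
deletionCount t (suc h) m g =
  ∑[ a < suc m ] (𝟙 (1 ≤? a) * 𝟙 (a ∸ t ≤? g) * deletionCount t h (m ∸ a) (g ∸ (a ∸ t)))

deletionCount-suc : ∀ t h m g → deletionCount t (suc h) m g ≡
  ∑[ i < m ] (𝟙 (suc i ∸ t ≤? g) * deletionCount t h (m ∸ suc i) (g ∸ (suc i ∸ t)))
deletionCount-suc t h m g = ∑-cong m (λ i _ → cong (_* deletionCount t h (m ∸ suc i) (g ∸ (suc i ∸ t)))
                                                     (*-identityˡ (𝟙 (suc i ∸ t ≤? g))))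

m<h⇒deletionCount≡0 : ∀ t h m g → m < h → deletionCount t h m g ≡ 0
m<h⇒deletionCount≡0 t (suc h) m g m<1+h = ∑-vanish (suc m) summand≡0
  where
  summand≡0 : ∀ a → a < suc m → 𝟙 (1 ≤? a) * 𝟙 (a ∸ t ≤? g) * deletionCount t h (m ∸ a) (g ∸ (a ∸ t)) ≡ 0
  summand≡0 zero    _           = refl
  summand≡0 (suc a) (s≤s a<m) = trans
    (cong (𝟙 (1 ≤? suc a) * 𝟙 (suc a ∸ t ≤? g) *_)
          (m<h⇒deletionCount≡0 t h (m ∸ suc a) _ (<-≤-trans (∸-monoʳ-< z<s a<m) (s≤s⁻¹ m<1+h))))
    (*-zeroʳ (𝟙 (1 ≤? suc a) * 𝟙 (suc a ∸ t ≤? g)))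

m<h+g⇒deletionCount≡0 : ∀ t h m g → 1 ≤ t → m < h + g → deletionCount t h m g ≡ 0
m<h+g⇒deletionCount≡0 t zero    m (suc g) _ _ = *-zeroʳ (δ₀ m)
m<h+g⇒deletionCount≡0 t (suc h) m g 1≤t m<1+h+g = ∑-vanish (suc m) summand≡0
  where
  summand≡0 : ∀ a → a < suc m → 𝟙 (1 ≤? a) * 𝟙 (a ∸ t ≤? g) * deletionCount t h (m ∸ a) (g ∸ (a ∸ t)) ≡ 0
  summand≡0 zero    _           = refl
  summand≡0 (suc a) (s≤s a<m) = trans
    (cong (_* deletionCount t h (m ∸ suc a) (g ∸ (suc a ∸ t))) (*-identityˡ (𝟙 (suc a ∸ t ≤? g))))
    (𝟙*-vanish (suc a ∸ t ≤? g) (λ d≤g → m<h+g⇒deletionCount≡0 t h (m ∸ suc a) _ 1≤t (remainder-< d≤g)))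
    where
    d = suc a ∸ t
    d<1+a : d < suc a
    d<1+a = s≤s (≤-trans (∸-monoʳ-≤ (suc a) 1≤t) (m∸n≤m a 0))
    remainder-< : d ≤ g → m ∸ suc a < h + (g ∸ d)
    remainder-< d≤g = +-cancelˡ-< (suc a) (m ∸ suc a) (h + (g ∸ d)) (begin-strict
      suc a + (m ∸ suc a)      ≡⟨ m+[n∸m]≡n a<m ⟩
      m                        <⟨ m<1+h+g ⟩
      suc h + g                ≡⟨ cong (λ x → suc h + x) (m∸n+n≡m d≤g) ⟨
      suc h + (g ∸ d + d)      ≡⟨ shuffle h (g ∸ d) d ⟩
      suc d + (h + (g ∸ d))    ≤⟨ +-monoˡ-≤ (h + (g ∸ d)) d<1+a ⟩
      suc a + (h + (g ∸ d))    ∎)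
      where
      open ≤-Reasoning
      shuffle : ∀ h e d → suc h + (e + d) ≡ suc d + (h + e)
      shuffle = solve-∀

deletionCount-deleteColumn : ∀ t h M g →
  deletionCount (suc t) h (h + M) g ≡ ∑[ f < suc h ] ((h C f) * deletionCount t f M g)
deletionCount-deleteColumn t zero    M g = sym (trans (+-identityʳ _) (*-identityˡ _))
deletionCount-deleteColumn t (suc h) M g = begin
  deletionCount (suc t) (suc h) (suc h + M) g
    ≡⟨ deletionCount-suc (suc t) h (suc h + M) g ⟩
  G 0 + ∑[ i < h + M ] G (suc i)
    ≡⟨ cong₂ _+_ firstPartOne firstPartAboveOne ⟩
  ∑[ f < suc h ] ((h C f) * deletionCount t f M g) + ∑[ f < suc h ] ((h C f) * deletionCount t (suc f) M g)
    ≡⟨ ∑-pascal h (λ f → deletionCount t f M g) ⟩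
  ∑[ f < suc (suc h) ] ((suc h C f) * deletionCount t f M g) ∎
  where
  open ≡-Reasoning
  G : ℕ → ℕ
  G i = 𝟙 (suc i ∸ suc t ≤? g) * deletionCount (suc t) h (suc h + M ∸ suc i) (g ∸ (suc i ∸ suc t))
  H : ℕ → ℕ → ℕ
  H f i = 𝟙 (suc i ∸ t ≤? g) * deletionCount t f (M ∸ suc i) (g ∸ (suc i ∸ t))

  firstPartOne : G 0 ≡ ∑[ f < suc h ] ((h C f) * deletionCount t f M g)
  firstPartOne rewrite 0∸n≡0 t = trans (+-identityʳ _) (deletionCount-deleteColumn t h M g)

  aboveM : ∀ i → M ≤ i → i < h + M → G (suc i) ≡ 0
  aboveM i M≤i i<h+M = trans (cong (𝟙 (suc i ∸ t ≤? g) *_) (m<h⇒deletionCount≡0 (suc t) h _ _ remainder<h))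
                            (*-zeroʳ (𝟙 (suc i ∸ t ≤? g)))
    where
    remainder<h : h + M ∸ suc i < h
    remainder<h = subst (h + M ∸ suc i <_) (m+n∸n≡m h M) (∸-monoʳ-< (s≤s M≤i) i<h+M)

  belowM : ∀ i → i < M → G (suc i) ≡ ∑[ f < suc h ] ((h C f) * H f i)
  belowM i i<M = begin
    𝟙 (suc i ∸ t ≤? g) * deletionCount (suc t) h (h + M ∸ suc i) g′
      ≡⟨ cong (λ m → 𝟙 (suc i ∸ t ≤? g) * deletionCount (suc t) h m g′) (+-∸-assoc h i<M) ⟩
    𝟙 (suc i ∸ t ≤? g) * deletionCount (suc t) h (h + (M ∸ suc i)) g′
      ≡⟨ cong (𝟙 (suc i ∸ t ≤? g) *_) (deletionCount-deleteColumn t h (M ∸ suc i) g′) ⟩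
    𝟙 (suc i ∸ t ≤? g) * ∑[ f < suc h ] ((h C f) * deletionCount t f (M ∸ suc i) g′)
      ≡⟨ *-distribˡ-∑ (suc h) (𝟙 (suc i ∸ t ≤? g)) (λ f → (h C f) * deletionCount t f (M ∸ suc i) g′) ⟩
    ∑[ f < suc h ] (𝟙 (suc i ∸ t ≤? g) * ((h C f) * deletionCount t f (M ∸ suc i) g′))
      ≡⟨ ∑-cong (suc h) (λ f _ → *-CS.x∙yz≈y∙xz (𝟙 (suc i ∸ t ≤? g)) (h C f) (deletionCount t f (M ∸ suc i) g′)) ⟩
    ∑[ f < suc h ] ((h C f) * H f i) ∎
    where
    g′ = g ∸ (suc i ∸ t)

  firstPartAboveOne : ∑[ i < h + M ] G (suc i) ≡ ∑[ f < suc h ] ((h C f) * deletionCount t (suc f) M g)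
  firstPartAboveOne = begin
    ∑[ i < h + M ] G (suc i)                        ≡⟨ ∑-truncate M (h + M) _ (m≤n+m M h) aboveM ⟩
    ∑[ i < M ] G (suc i)                            ≡⟨ ∑-cong M belowM ⟩
    ∑[ i < M ] ∑[ f < suc h ] ((h C f) * H f i)     ≡⟨ ∑-comm M (suc h) (λ i f → (h C f) * H f i) ⟩
    ∑[ f < suc h ] ∑[ i < M ] ((h C f) * H f i)     ≡⟨ ∑-cong (suc h) (λ f _ → *-distribˡ-∑ M (h C f) (H f)) ⟨
    ∑[ f < suc h ] ((h C f) * ∑[ i < M ] H f i)     ≡⟨ ∑-cong (suc h) (λ f _ → cong ((h C f) *_) (deletionCount-suc t f M g)) ⟨
    ∑[ f < suc h ] ((h C f) * deletionCount t (suc f) M g) ∎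

m≢g⇒deletionCount₀≡0 : ∀ k M g → M ≢ g → deletionCount 0 k M g ≡ 0
m≢g⇒deletionCount₀≡0 zero    zero    zero    M≢g = ⊥-elim (M≢g refl)
m≢g⇒deletionCount₀≡0 zero    zero    (suc g) _   = refl
m≢g⇒deletionCount₀≡0 zero    (suc M) g       _   = refl
m≢g⇒deletionCount₀≡0 (suc k) M       g       M≢g = ∑-vanish (suc M) summand≡0
  where
  summand≡0 : ∀ a → a < suc M → 𝟙 (1 ≤? a) * 𝟙 (a ≤? g) * deletionCount 0 k (M ∸ a) (g ∸ a) ≡ 0
  summand≡0 a a≤M = trans (*-assoc (𝟙 (1 ≤? a)) (𝟙 (a ≤? g)) (deletionCount 0 k (M ∸ a) (g ∸ a)))
    (trans (cong (𝟙 (1 ≤? a) *_) (𝟙*-vanish (a ≤? g) (λ a≤g →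
             m≢g⇒deletionCount₀≡0 k (M ∸ a) (g ∸ a) (M≢g ∘ ∸-cancelʳ-≡ (s≤s⁻¹ a≤M) a≤g))))
           (*-zeroʳ (𝟙 (1 ≤? a))))

-- Without deleting columns the weight is the total, so this counts all compositions of g into k parts.
compositions : ℕ → ℕ → ℕ
compositions g k = deletionCount 0 k g g

compositions-pascal : ∀ g k → compositions (suc g) (suc k) ≡ compositions g k + compositions g (suc k)
compositions-pascal g k = cong₂ _+_ (*-identityˡ (compositions g k))
  (trans (∑-cong g (λ i _ → cong (_* compositions (g ∸ suc i) k) (*-identityˡ (𝟙 (suc i ≤? g))))) (sym (deletionCount-suc 0 k g g)))

compositions-suc : ∀ g k → compositions (suc g) (suc k) ≡ g C k
compositions-suc zero    zero    = refl
compositions-suc zero    (suc k) = compositions-pascal 0 (suc k)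
compositions-suc (suc g) zero    = trans (compositions-pascal (suc g) 0) (compositions-suc g 0)
compositions-suc (suc g) (suc k) = begin
  compositions (suc (suc g)) (suc (suc k))             ≡⟨ compositions-pascal (suc g) (suc k) ⟩
  compositions (suc g) (suc k) + compositions (suc g) (suc (suc k))
                                                       ≡⟨ cong₂ _+_ (compositions-suc g k) (compositions-suc g (suc k)) ⟩
  (g C k) + (g C suc k)                                ≡⟨ nCk+nC[k+1]≡[n+1]C[k+1] g k ⟩
  suc g C suc k                                        ∎
  where open ≡-Reasoning

[1+k]*[1+n]C[1+k]≡[1+n]*nCk : ∀ n k → suc k * (suc n C suc k) ≡ suc n * (n C k)
[1+k]*[1+n]C[1+k]≡[1+n]*nCk zero    zero    = refl
[1+k]*[1+n]C[1+k]≡[1+n]*nCk zero    (suc k) = *-zeroʳ (suc (suc k))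
[1+k]*[1+n]C[1+k]≡[1+n]*nCk (suc n) zero    = trans (*-identityˡ _) (trans (nC1≡n (suc (suc n))) (sym (*-identityʳ _)))
[1+k]*[1+n]C[1+k]≡[1+n]*nCk (suc n) (suc k) = begin
  suc (suc k) * (suc (suc n) C suc (suc k))       ≡⟨ cong (suc (suc k) *_) (nCk+nC[k+1]≡[n+1]C[k+1] (suc n) (suc k)) ⟨
  suc (suc k) * (w + z)                           ≡⟨ spread k w z ⟩
  w + suc k * w + suc (suc k) * z                 ≡⟨ cong₂ (λ p q → w + p + q) ([1+k]*[1+n]C[1+k]≡[1+n]*nCk n k)
                                                                            ([1+k]*[1+n]C[1+k]≡[1+n]*nCk n (suc k)) ⟩
  w + suc n * u + suc n * v                       ≡⟨ collect n w u v ⟩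
  w + suc n * (u + v)                             ≡⟨ cong (λ x → w + suc n * x) (nCk+nC[k+1]≡[n+1]C[k+1] n k) ⟩
  w + suc n * w                                   ∎
  where
  open ≡-Reasoning
  u = n C k
  v = n C suc k
  w = suc n C suc k
  z = suc n C suc (suc k)
  spread : ∀ k x y → suc (suc k) * (x + y) ≡ x + suc k * x + suc (suc k) * y
  spread = solve-∀
  collect : ∀ n x y z → x + suc n * y + suc n * z ≡ x + suc n * (y + z)
  collect = solve-∀

compositions-absorb : ∀ g k → g * compositions g k ≡ k * (g C k)
compositions-absorb zero    zero    = refl
compositions-absorb zero    (suc k) = sym (*-zeroʳ (suc k))
compositions-absorb (suc g) zero    = *-zeroʳ (suc g)
compositions-absorb (suc g) (suc k) =
  trans (cong (suc g *_) (compositions-suc g k)) (sym ([1+k]*[1+n]C[1+k]≡[1+n]*nCk g k))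

-- Chains of binomial coefficients

-- ∑ C(x,f₁)C(f₁,f₂)⋯C(f_n,k) over f₁+⋯+f_n = E; the binomials vanish unless x ≥ f₁ ≥ ⋯ ≥ f_n ≥ k.
chainSum : (n x E k : ℕ) → ℕ
chainSum zero    x E k = δ₀ E * (x C k)
chainSum (suc n) x E k = ∑[ f < suc x ] (𝟙 (f ≤? E) * (x C f) * chainSum n f (E ∸ f) k)

deletionCount≡∑chainSum : ∀ n x g E →
  deletionCount (suc n) x (x + (g + E)) g ≡ ∑[ k < suc g ] (compositions g k * chainSum n x E k)
deletionCount≡∑chainSum zero x g zero = begin
  deletionCount 1 x (x + (g + 0)) g
    ≡⟨ deletionCount-deleteColumn 0 x (g + 0) g ⟩
  ∑[ f < suc x ] ((x C f) * deletionCount 0 f (g + 0) g)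
    ≡⟨ cong (λ m → ∑[ f < suc x ] ((x C f) * deletionCount 0 f m g)) (+-identityʳ g) ⟩
  ∑[ f < suc x ] ((x C f) * compositions g f)
    ≡⟨ ∑-bounds (suc x) (suc g) (λ f → (x C f) * compositions g f) (λ f x<f → cong (_* compositions g f) (k>n⇒nCk≡0 x<f))
                                  (λ f g<f → trans (cong ((x C f) *_) (m<h⇒deletionCount≡0 0 f g g g<f)) (*-zeroʳ (x C f))) ⟩
  ∑[ k < suc g ] ((x C k) * compositions g k)
    ≡⟨ ∑-cong (suc g) (λ k _ → trans (*-comm (x C k) (compositions g k)) (cong (compositions g k *_) (sym (*-identityˡ (x C k))))) ⟩
  ∑[ k < suc g ] (compositions g k * chainSum 0 x 0 k) ∎
  where open ≡-Reasoning
deletionCount≡∑chainSum zero x g (suc e) = begin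
  deletionCount 1 x (x + (g + suc e)) g
    ≡⟨ deletionCount-deleteColumn 0 x (g + suc e) g ⟩
  ∑[ f < suc x ] ((x C f) * deletionCount 0 f (g + suc e) g)
    ≡⟨ ∑-vanish (suc x) (λ f _ → trans (cong ((x C f) *_) (m≢g⇒deletionCount₀≡0 f (g + suc e) g g+1+e≢g)) (*-zeroʳ (x C f))) ⟩
  0
    ≡⟨ ∑-vanish (suc g) (λ k _ → *-zeroʳ (compositions g k)) ⟨
  ∑[ k < suc g ] (compositions g k * chainSum 0 x (suc e) k) ∎
  where
  open ≡-Reasoning
  g+1+e≢g : g + suc e ≢ g
  g+1+e≢g = m+1+n≢m g
deletionCount≡∑chainSum (suc n) x g E = begin
  deletionCount (suc (suc n)) x (x + (g + E)) g
    ≡⟨ deletionCount-deleteColumn (suc n) x (g + E) g ⟩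
  ∑[ f < suc x ] ((x C f) * deletionCount (suc n) f (g + E) g)
    ≡⟨ ∑-cong (suc x) (λ f _ → trans (firstLink f (f ≤? E)) (distribute (𝟙 (f ≤? E) * (x C f)) f)) ⟩
  ∑[ f < suc x ] ∑[ k < suc g ] (compositions g k * (𝟙 (f ≤? E) * (x C f) * chainSum n f (E ∸ f) k))
    ≡⟨ ∑-comm (suc x) (suc g) (λ f k → compositions g k * (𝟙 (f ≤? E) * (x C f) * chainSum n f (E ∸ f) k)) ⟩
  ∑[ k < suc g ] ∑[ f < suc x ] (compositions g k * (𝟙 (f ≤? E) * (x C f) * chainSum n f (E ∸ f) k))
    ≡⟨ ∑-cong (suc g) (λ k _ → *-distribˡ-∑ (suc x) (compositions g k) (λ f → 𝟙 (f ≤? E) * (x C f) * chainSum n f (E ∸ f) k)) ⟨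
  ∑[ k < suc g ] (compositions g k * chainSum (suc n) x E k) ∎
  where
  open ≡-Reasoning
  rest : ℕ → ℕ
  rest f = ∑[ k < suc g ] (compositions g k * chainSum n f (E ∸ f) k)

  firstLink : ∀ f (d : Dec (f ≤ E)) → (x C f) * deletionCount (suc n) f (g + E) g ≡ 𝟙 d * (x C f) * rest f
  firstLink f (yes f≤E) = begin
    (x C f) * deletionCount (suc n) f (g + E) g                ≡⟨ cong (λ m → (x C f) * deletionCount (suc n) f m g) split ⟩
    (x C f) * deletionCount (suc n) f (f + (g + (E ∸ f))) g    ≡⟨ cong ((x C f) *_) (deletionCount≡∑chainSum n f g (E ∸ f)) ⟩
    (x C f) * rest f                                           ≡⟨ cong (_* rest f) (*-identityˡ (x C f)) ⟨
    1 * (x C f) * rest f                                       ∎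
    where
    split : g + E ≡ f + (g + (E ∸ f))
    split = trans (cong (_+_ g) (sym (m+[n∸m]≡n f≤E))) (+-CS.x∙yz≈y∙xz g f (E ∸ f))
  firstLink f (no f≰E) =
    trans (cong ((x C f) *_) (m<h+g⇒deletionCount≡0 (suc n) f (g + E) g (s≤s z≤n) g+E<f+g)) (*-zeroʳ (x C f))
    where
    g+E<f+g : g + E < f + g
    g+E<f+g = subst (g + E <_) (+-comm g f) (+-monoʳ-< g (≰⇒> f≰E))

  distribute : ∀ c f → c * rest f ≡ ∑[ k < suc g ] (compositions g k * (c * chainSum n f (E ∸ f) k))
  distribute c f = trans (*-distribˡ-∑ (suc g) c (λ k → compositions g k * chainSum n f (E ∸ f) k))
                         (∑-cong (suc g) (λ k _ → *-CS.x∙yz≈y∙xz c (compositions g k) (chainSum n f (E ∸ f) k)))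

-- The enumerations of the statement

counted? : ∀ s m h g (v : Vec ℕ h) → Dec (IsComposition m h v × deletionWeight s v ≡ g)
counted? s m h g v = isComposition? m h v ×-dec (deletionWeight s v ≟ g)

firstPartFits? : ∀ t m g a → Dec (((1 ≤ a) × (a ≤ m)) × (a ∸ t ≤ g))
firstPartFits? t m g a = ((1 ≤? a) ×-dec (a ≤? m)) ×-dec (a ∸ t ≤? g)

𝟙-counted-∷ : ∀ s m h g a (v : Vec ℕ h) →
  𝟙 (counted? s m (suc h) g (a V.∷ v)) ≡ 𝟙 (firstPartFits? (suc s) m g a) * 𝟙 (counted? s (m ∸ a) h (g ∸ (a ∸ suc s)) v)
𝟙-counted-∷ s m h g a v = trans (𝟙-cong (counted? s m (suc h) g (a V.∷ v)) (firstPartFits? (suc s) m g a ×-dec counted? s (m ∸ a) h g′ v) split join)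
                                (𝟙-× (firstPartFits? (suc s) m g a) (counted? s (m ∸ a) h g′ v))
  where
  d = a ∸ suc s
  g′ = g ∸ d
  split : IsComposition m (suc h) (a V.∷ v) × deletionWeight s (a V.∷ v) ≡ g →
          (((1 ≤ a) × (a ≤ m)) × (d ≤ g)) × (IsComposition (m ∸ a) h v × deletionWeight s v ≡ g′)
  split ((1≤a ∷ parts , a+∑v≡m) , d+w≡g) =
    ((1≤a , subst (a ≤_) a+∑v≡m (m≤m+n a _)) , subst (d ≤_) d+w≡g (m≤m+n d _)) ,
    ((parts , trans (sym (m+n∸m≡n a _)) (cong (_∸ a) a+∑v≡m)) , trans (sym (m+n∸m≡n d _)) (cong (_∸ d) d+w≡g))
  join : (((1 ≤ a) × (a ≤ m)) × (d ≤ g)) × (IsComposition (m ∸ a) h v × deletionWeight s v ≡ g′) →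
         IsComposition m (suc h) (a V.∷ v) × deletionWeight s (a V.∷ v) ≡ g
  join (((1≤a , a≤m) , d≤g) , ((parts , ∑v≡m∸a) , w≡g∸d)) =
    ((1≤a ∷ parts) , trans (cong (_+_ a) ∑v≡m∸a) (m+[n∸m]≡n a≤m)) , trans (cong (_+_ d) w≡g∸d) (m+[n∸m]≡n d≤g)

boxSum-counted : ∀ s B h m g → m < B → boxSum h B (𝟙 ∘ counted? s m h g) ≡ deletionCount (suc s) h m g
boxSum-counted s B zero    zero    zero    _   = refl
boxSum-counted s B zero    zero    (suc g) _   = refl
boxSum-counted s B zero    (suc m) g       _   = refl
boxSum-counted s B (suc h) m       g       m<B = begin
  boxSum (suc h) B (𝟙 ∘ counted? s m (suc h) g)
    ≡⟨ boxSum-suc h B (𝟙 ∘ counted? s m (suc h) g) ⟩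
  ∑[ a < B ] boxSum h B (λ v → 𝟙 (counted? s m (suc h) g (a V.∷ v)))
    ≡⟨ ∑-cong B (λ a _ → trans (boxSum-cong h B (𝟙-counted-∷ s m h g a))
                               (sym (*-distribˡ-boxSum h B (fits a) (𝟙 ∘ counted? s (m ∸ a) h (g ∸ (a ∸ t)))))) ⟩
  ∑[ a < B ] (fits a * boxSum h B (𝟙 ∘ counted? s (m ∸ a) h (g ∸ (a ∸ t))))
    ≡⟨ ∑-cong B (λ a _ → byInduction a (firstPartFits? t m g a)) ⟩
  ∑[ a < B ] (fits a * deletionCount t h (m ∸ a) (g ∸ (a ∸ t)))
    ≡⟨ ∑-truncate (suc m) B _ m<B (λ a m<a _ → cong (_* deletionCount t h (m ∸ a) (g ∸ (a ∸ t)))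
                                                     (𝟙-no (λ ((_ , a≤m) , _) → <⇒≱ m<a a≤m) (firstPartFits? t m g a))) ⟩
  ∑[ a < suc m ] (fits a * deletionCount t h (m ∸ a) (g ∸ (a ∸ t)))
    ≡⟨ ∑-cong (suc m) (λ a a<1+m → cong (_* deletionCount t h (m ∸ a) (g ∸ (a ∸ t))) (fits≡ a (s≤s⁻¹ a<1+m))) ⟩
  deletionCount t (suc h) m g ∎
  where
  open ≡-Reasoning
  t = suc s
  fits : ℕ → ℕ
  fits a = 𝟙 (firstPartFits? t m g a)
  byInduction : ∀ a (d : Dec _) → 𝟙 d * boxSum h B (𝟙 ∘ counted? s (m ∸ a) h (g ∸ (a ∸ t))) ≡ 𝟙 d * deletionCount t h (m ∸ a) (g ∸ (a ∸ t))
  byInduction a (yes ((_ , a≤m) , _)) = cong (1 *_) (boxSum-counted s B h (m ∸ a) _ (≤-<-trans (m∸n≤m m a) m<B))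
  byInduction a (no _)                = refl
  fits≡ : ∀ a → a ≤ m → fits a ≡ 𝟙 (1 ≤? a) * 𝟙 (a ∸ t ≤? g)
  fits≡ a a≤m = trans (𝟙-× ((1 ≤? a) ×-dec (a ≤? m)) (a ∸ t ≤? g))
    (cong (_* 𝟙 (a ∸ t ≤? g)) (trans (𝟙-× (1 ≤? a) (a ≤? m))
                                     (trans (cong (𝟙 (1 ≤? a) *_) (𝟙-yes a≤m (a ≤? m))) (*-identityʳ (𝟙 (1 ≤? a))))))

compositionCount≡deletionCount : ∀ s m h g → compositionCount s m h g ≡ deletionCount (suc s) h m g
compositionCount≡deletionCount s m h g =
  trans (length-filter≡sum-𝟙 (counted? s m h g) (vecsBelow h (suc m))) (boxSum-counted s (suc m) h m g ≤-refl)

chainWeight : ∀ n (x E k : ℕ) → Vec ℕ n → ℕ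
chainWeight n x E k f = 𝟙 (descending? (x ∷ toList f ++ [ k ]) ×-dec (V.sum f ≟ E)) * binomChain (x ∷ toList f ++ [ k ])

chainWeight-[] : ∀ x E k → chainWeight 0 x E k V.[] ≡ chainSum 0 x E k
chainWeight-[] x E k = begin
  𝟙 (D ×-dec (0 ≟ E)) * ((x C k) * 1)    ≡⟨ cong₂ _*_ (𝟙-× D (0 ≟ E)) (*-identityʳ (x C k)) ⟩
  𝟙 D * 𝟙 (0 ≟ E) * (x C k)              ≡⟨ *-CS.xy∙z≈y∙xz (𝟙 D) (𝟙 (0 ≟ E)) (x C k) ⟩
  𝟙 (0 ≟ E) * (𝟙 D * (x C k))            ≡⟨ cong₂ _*_ (𝟙[0≟E]≡δ₀E E) (binomialSupport (k ≤? x)) ⟩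
  δ₀ E * (x C k)                         ∎
  where
  open ≡-Reasoning
  D = descending? (x ∷ k ∷ [])
  𝟙[0≟E]≡δ₀E : ∀ E → 𝟙 (0 ≟ E) ≡ δ₀ E
  𝟙[0≟E]≡δ₀E zero    = refl
  𝟙[0≟E]≡δ₀E (suc _) = refl
  binomialSupport : (d : Dec (k ≤ x)) → 𝟙 (d ×-dec yes tt) * (x C k) ≡ x C k
  binomialSupport (yes _)   = +-identityʳ (x C k)
  binomialSupport (no k≰x) = sym (k>n⇒nCk≡0 (≰⇒> k≰x))

chainWeight-∷ : ∀ n x E k a (f : Vec ℕ n) →
  chainWeight (suc n) x E k (a V.∷ f) ≡ 𝟙 (a ≤? x) * (𝟙 (a ≤? E) * (x C a)) * chainWeight n a (E ∸ a) k f
chainWeight-∷ n x E k a f = begin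
  𝟙 (((a ≤? x) ×-dec D) ×-dec (a + Σf ≟ E)) * ((x C a) * B)
    ≡⟨ cong (_* ((x C a) * B)) (𝟙-cong (((a ≤? x) ×-dec D) ×-dec (a + Σf ≟ E)) ((a ≤? x) ×-dec ((a ≤? E) ×-dec R)) split join) ⟩
  𝟙 ((a ≤? x) ×-dec ((a ≤? E) ×-dec R)) * ((x C a) * B)
    ≡⟨ cong (_* ((x C a) * B)) (trans (𝟙-× (a ≤? x) ((a ≤? E) ×-dec R)) (cong (𝟙 (a ≤? x) *_) (𝟙-× (a ≤? E) R))) ⟩
  𝟙 (a ≤? x) * (𝟙 (a ≤? E) * 𝟙 R) * ((x C a) * B)
    ≡⟨ shuffle (𝟙 (a ≤? x)) (𝟙 (a ≤? E)) (𝟙 R) (x C a) B ⟩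
  𝟙 (a ≤? x) * (𝟙 (a ≤? E) * (x C a)) * (𝟙 R * B) ∎
  where
  open ≡-Reasoning
  D = descending? (a ∷ toList f ++ [ k ])
  Σf = V.sum f
  R = D ×-dec (Σf ≟ E ∸ a)
  B = binomChain (a ∷ toList f ++ [ k ])
  split : ∀ {A X} → (A × X) × (a + Σf ≡ E) → A × ((a ≤ E) × (X × (Σf ≡ E ∸ a)))
  split ((p , q) , a+Σf≡E) = p , (subst (a ≤_) a+Σf≡E (m≤m+n a Σf) , (q , trans (sym (m+n∸m≡n a Σf)) (cong (_∸ a) a+Σf≡E)))
  join : ∀ {A X} → A × ((a ≤ E) × (X × (Σf ≡ E ∸ a))) → (A × X) × (a + Σf ≡ E)
  join (p , (a≤E , (q , Σf≡E∸a))) = (p , q) , trans (cong (_+_ a) Σf≡E∸a) (m+[n∸m]≡n a≤E)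
  shuffle : ∀ p q r c b → p * (q * r) * (c * b) ≡ p * (q * c) * (r * b)
  shuffle = solve-∀

boxSum-chainWeight : ∀ n B x E k → x < B → boxSum n B (chainWeight n x E k) ≡ chainSum n x E k
boxSum-chainWeight zero    B x E k _   = trans (+-identityʳ _) (chainWeight-[] x E k)
boxSum-chainWeight (suc n) B x E k x<B = begin
  boxSum (suc n) B (chainWeight (suc n) x E k)
    ≡⟨ boxSum-suc n B (chainWeight (suc n) x E k) ⟩
  ∑[ a < B ] boxSum n B (λ f → chainWeight (suc n) x E k (a V.∷ f))
    ≡⟨ ∑-cong B (λ a _ → trans (boxSum-cong n B (chainWeight-∷ n x E k a))
                               (sym (*-distribˡ-boxSum n B (weight a) (chainWeight n a (E ∸ a) k)))) ⟩
  ∑[ a < B ] (weight a * boxSum n B (chainWeight n a (E ∸ a) k))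
    ≡⟨ ∑-truncate (suc x) B _ x<B (λ a x<a _ → cong (λ w → w * (𝟙 (a ≤? E) * (x C a)) * boxSum n B (chainWeight n a (E ∸ a) k))
                                                     (𝟙-no (<⇒≱ x<a) (a ≤? x))) ⟩
  ∑[ a < suc x ] (weight a * boxSum n B (chainWeight n a (E ∸ a) k))
    ≡⟨ ∑-cong (suc x) (λ a a≤x → cong₂ _*_ (weight≡ a (s≤s⁻¹ a≤x)) (boxSum-chainWeight n B a (E ∸ a) k (<-≤-trans a≤x x<B))) ⟩
  chainSum (suc n) x E k ∎
  where
  open ≡-Reasoning
  weight : ℕ → ℕ
  weight a = 𝟙 (a ≤? x) * (𝟙 (a ≤? E) * (x C a))
  weight≡ : ∀ a → a ≤ x → weight a ≡ 𝟙 (a ≤? E) * (x C a)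
  weight≡ a a≤x = trans (cong (_* (𝟙 (a ≤? E) * (x C a))) (𝟙-yes a≤x (a ≤? x))) (+-identityʳ _)

boxSum-chains : ∀ s x k E {p} {P : ℕ → Set p} (P? : ∀ y → Dec (P y)) → (∀ y → P y → y ≡ E) → (∀ y → y ≡ E → P y) →
  boxSum s (suc x) (λ f → 𝟙 (descending? (x ∷ toList f ++ [ k ]) ×-dec P? (V.sum f)) * binomChain (x ∷ toList f ++ [ k ]))
    ≡ chainSum s x E k
boxSum-chains s x k E P? P⇒≡E ≡E⇒P = trans
  (boxSum-cong s (suc x) (λ f → cong (_* binomChain (x ∷ toList f ++ [ k ]))
    (𝟙-cong (descending? (x ∷ toList f ++ [ k ]) ×-dec P? (V.sum f)) (descending? (x ∷ toList f ++ [ k ]) ×-dec (V.sum f ≟ E))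
            (λ (d , p) → d , P⇒≡E (V.sum f) p) (λ (d , e) → d , ≡E⇒P (V.sum f) e))))
  (boxSum-chainWeight s (suc x) x E k ≤-refl)

innerSum≡chainSum : ∀ s h g E k → innerSum s (h + g + E) h g k ≡ k * (g C k) * chainSum s h E k
innerSum≡chainSum s h g E k = begin
  innerSum s (h + g + E) h g k
    ≡⟨ sum-map-filter P? (λ f → k * B f * (g C k)) (vecsBelow s (suc h)) ⟩
  boxSum s (suc h) (λ f → 𝟙 (P? f) * (k * B f * (g C k)))
    ≡⟨ boxSum-cong s (suc h) (λ f → shuffle (𝟙 (P? f)) k (B f) (g C k)) ⟩
  boxSum s (suc h) (λ f → k * (g C k) * (𝟙 (P? f) * B f))
    ≡⟨ *-distribˡ-boxSum s (suc h) (k * (g C k)) (λ f → 𝟙 (P? f) * B f) ⟨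
  k * (g C k) * boxSum s (suc h) (λ f → 𝟙 (P? f) * B f)
    ≡⟨ cong (k * (g C k) *_) (boxSum-chains s h k E (λ y → y + h + g ≟ h + g + E)
                                (λ y e → +-cancelˡ-≡ (h + g) y E (trans (sym (shift y)) e))
                                (λ y e → trans (shift y) (cong (_+_ (h + g)) e))) ⟩
  k * (g C k) * chainSum s h E k ∎
  where
  open ≡-Reasoning
  B : Vec ℕ s → ℕ
  B f = binomChain (h ∷ toList f ++ [ k ])
  P? = λ (f : Vec ℕ s) → descending? (h ∷ toList f ++ [ k ]) ×-dec (V.sum f + h + g ≟ h + g + E)
  shift : ∀ y → y + h + g ≡ h + g + y
  shift y = trans (+-assoc y h g) (+-comm y (h + g))
  shuffle : ∀ i k b c → i * (k * b * c) ≡ k * c * (i * b)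
  shuffle = solve-∀

m<h+g⇒innerSum≡0 : ∀ s m h g k → m < h + g → innerSum s m h g k ≡ 0
m<h+g⇒innerSum≡0 s m h g k m<h+g = trans (sum-map-filter P? (λ f → k * binomChain (h ∷ toList f ++ [ k ]) * (g C k)) (vecsBelow s (suc h)))
  (boxSum-vanish s (suc h) (λ f → cong (_* (k * binomChain (h ∷ toList f ++ [ k ]) * (g C k)))
    (𝟙-no (λ (_ , e) → <⇒≱ m<h+g (subst (h + g ≤_) (trans (shift (V.sum f)) e) (m≤m+n (h + g) (V.sum f)))) (P? f))))
  where
  P? = λ (f : Vec ℕ s) → descending? (h ∷ toList f ++ [ k ]) ×-dec (V.sum f + h + g ≟ m)
  shift : ∀ y → h + g + y ≡ y + h + g
  shift y = trans (+-comm (h + g) y) (sym (+-assoc y h g))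

descending-∷ʳ0 : ∀ x xs → Descending (x ∷ xs) → Descending (x ∷ xs ++ [ 0 ])
descending-∷ʳ0 x []       _       = z≤n , tt
descending-∷ʳ0 x (y ∷ ys) (p , d) = p , descending-∷ʳ0 y ys d

descending-∷ʳ0⁻ : ∀ x xs → Descending (x ∷ xs ++ [ 0 ]) → Descending (x ∷ xs)
descending-∷ʳ0⁻ x []       _       = tt
descending-∷ʳ0⁻ x (y ∷ ys) (p , d) = p , descending-∷ʳ0⁻ y ys d

binomChain-∷ʳ0 : ∀ x xs → binomChain (x ∷ xs ++ [ 0 ]) ≡ binomChain (x ∷ xs)
binomChain-∷ʳ0 x []       = refl
binomChain-∷ʳ0 x (y ∷ ys) = cong ((x C y) *_) (binomChain-∷ʳ0 y ys)

chains0≡chainSum : ∀ s h E → sum (map (λ f → binomChain (h ∷ toList f)) (chains0 s (h + E) h)) ≡ chainSum s h E 0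
chains0≡chainSum s h E = begin
  sum (map (λ f → binomChain (h ∷ toList f)) (chains0 s (h + E) h))
    ≡⟨ sum-map-filter P? (λ f → binomChain (h ∷ toList f)) (vecsBelow s (suc h)) ⟩
  boxSum s (suc h) (λ f → 𝟙 (P? f) * binomChain (h ∷ toList f))
    ≡⟨ boxSum-cong s (suc h) appendZero ⟩
  boxSum s (suc h) (λ f → 𝟙 (descending? (h ∷ toList f ++ [ 0 ]) ×-dec (V.sum f + h ≟ h + E)) * binomChain (h ∷ toList f ++ [ 0 ]))
    ≡⟨ boxSum-chains s h 0 E (λ y → y + h ≟ h + E)
         (λ y e → +-cancelˡ-≡ h y E (trans (+-comm h y) e)) (λ y e → trans (+-comm y h) (cong (_+_ h) e)) ⟩
  chainSum s h E 0 ∎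
  where
  open ≡-Reasoning
  P? = λ (f : Vec ℕ s) → descending? (h ∷ toList f) ×-dec (V.sum f + h ≟ h + E)
  appendZero : ∀ f → 𝟙 (P? f) * binomChain (h ∷ toList f) ≡
    𝟙 (descending? (h ∷ toList f ++ [ 0 ]) ×-dec (V.sum f + h ≟ h + E)) * binomChain (h ∷ toList f ++ [ 0 ])
  appendZero f = cong₂ _*_
    (𝟙-cong (P? f) (descending? (h ∷ toList f ++ [ 0 ]) ×-dec (V.sum f + h ≟ h + E))
            (λ (d , e) → descending-∷ʳ0 h (toList f) d , e) (λ (d , e) → descending-∷ʳ0⁻ h (toList f) d , e))
    (sym (binomChain-∷ʳ0 h (toList f)))

sum-innerSum≡*deletionCount : ∀ s m h g → sum (map (innerSum s m h g) (oneTo g)) ≡ g * deletionCount (suc s) h m g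
sum-innerSum≡*deletionCount s m h g with h + g ≤? m
... | no h+g≰m = begin
  sum (map (innerSum s m h g) (oneTo g))      ≡⟨ cong sum (map-∘ (upTo g)) ⟨
  sum (map (innerSum s m h g ∘ suc) (upTo g)) ≡⟨ sum-map-cong (upTo g) (λ k → m<h+g⇒innerSum≡0 s m h g (suc k) m<h+g) ⟩
  sum (map (λ _ → 0) (upTo g))                ≡⟨ sum-map-applyUpTo g (λ k → k) (λ _ → 0) ⟩
  ∑[ _ < g ] 0                                ≡⟨ ∑-vanish g (λ _ _ → refl) ⟩
  0                                           ≡⟨ *-zeroʳ g ⟨
  g * 0                                       ≡⟨ cong (g *_) (m<h+g⇒deletionCount≡0 (suc s) h m g (s≤s z≤n) m<h+g) ⟨
  g * deletionCount (suc s) h m g             ∎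
  where
  open ≡-Reasoning
  m<h+g = ≰⇒> h+g≰m
... | yes h+g≤m with m≤n⇒∃[o]m+o≡n h+g≤m
... | E , refl = begin
  sum (map (innerSum s (h + g + E) h g) (oneTo g))
    ≡⟨ cong sum (map-∘ (upTo g)) ⟨
  sum (map (innerSum s (h + g + E) h g ∘ suc) (upTo g))
    ≡⟨ sum-map-applyUpTo g (λ k → k) (innerSum s (h + g + E) h g ∘ suc) ⟩
  ∑[ k < g ] innerSum s (h + g + E) h g (suc k)
    ≡⟨ ∑-cong g (λ k _ → innerSum≡chainSum s h g E (suc k)) ⟩
  ∑[ k < suc g ] (k * (g C k) * chainSum s h E k)
    ≡⟨ ∑-cong (suc g) (λ k _ → cong (_* chainSum s h E k) (compositions-absorb g k)) ⟨
  ∑[ k < suc g ] (g * compositions g k * chainSum s h E k)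
    ≡⟨ ∑-cong (suc g) (λ k _ → *-assoc g (compositions g k) (chainSum s h E k)) ⟩
  ∑[ k < suc g ] (g * (compositions g k * chainSum s h E k))
    ≡⟨ *-distribˡ-∑ (suc g) g (λ k → compositions g k * chainSum s h E k) ⟨
  g * ∑[ k < suc g ] (compositions g k * chainSum s h E k)
    ≡⟨ cong (g *_) (deletionCount≡∑chainSum s h g E) ⟨
  g * deletionCount (suc s) h (h + (g + E)) g
    ≡⟨ cong (λ m → g * deletionCount (suc s) h m g) (+-assoc h g E) ⟨
  g * deletionCount (suc s) h (h + g + E) g ∎
  where open ≡-Reasoning

n/1≡[1+d]*n/[1+d] : ∀ n d → (+ n) / 1 ≡ (+ (suc d * n)) / suc d
n/1≡[1+d]*n/[1+d] n d = fromℚᵘ-cong {mkℚᵘ (+ n) 0} {mkℚᵘ (+ (suc d * n)) d} (*≡* (begin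
  + n ℤ.* + suc d        ≡⟨ pos-* n (suc d) ⟨
  + (n * suc d)          ≡⟨ cong +_ (*-comm n (suc d)) ⟩
  + (suc d * n)          ≡⟨ cong +_ (*-identityʳ (suc d * n)) ⟨
  + (suc d * n * 1)      ≡⟨ pos-* (suc d * n) 1 ⟩
  + (suc d * n) ℤ.* + 1  ∎))
  where open ≡-Reasoning

mainTheorem15 : (s m h g : ℕ) → 1 ≤ s → 1 ≤ h → h ≤ m →
    (+ compositionCount s m h g) / 1 ≡ c s m h g
mainTheorem15 s m h zero _ _ h≤m with m≤n⇒∃[o]m+o≡n h≤m
... | E , refl = cong (λ n → (+ n) / 1) (begin
  compositionCount s (h + E) h 0            ≡⟨ compositionCount≡deletionCount s (h + E) h 0 ⟩
  deletionCount (suc s) h (h + (0 + E)) 0   ≡⟨ deletionCount≡∑chainSum s h 0 E ⟩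
  1 * chainSum s h E 0 + 0                  ≡⟨ trans (+-identityʳ _) (*-identityˡ _) ⟩
  chainSum s h E 0                          ≡⟨ chains0≡chainSum s h E ⟨
  sum (map (λ f → binomChain (h ∷ toList f)) (chains0 s (h + E) h)) ∎)
  where open ≡-Reasoning
mainTheorem15 s m h (suc g) _ _ _ = begin
  (+ compositionCount s m h (suc g)) / 1                      ≡⟨ n/1≡[1+d]*n/[1+d] (compositionCount s m h (suc g)) g ⟩
  (+ (suc g * compositionCount s m h (suc g))) / suc g        ≡⟨ cong (λ n → (+ (suc g * n)) / suc g)
                                                                       (compositionCount≡deletionCount s m h (suc g)) ⟩
  (+ (suc g * deletionCount (suc s) h m (suc g))) / suc g     ≡⟨ cong (λ n → (+ n) / suc g) (sum-innerSum≡*deletionCount s m h (suc g)) ⟨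
  c s m h (suc g)                                             ∎
  where open ≡-Reasoning
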